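{- Let $\phi$ be a Hecke–Maass cusp form for $SL(4,\mathbb Z)$ with Fourier coefficients $A(m_1,m_2,m_3)$ normalized by $A(1,1,1)=1$. For any prime $p$ and non-negative integers $k,\ell,n$, $$A(p^k,1,1)A(1,p^\ell,p^n)=A(p^k,p^\ell,p^n)+A(p^{k-1},1,1)A(1,p^\ell,p^{n-1})+A(p^{k-1},1,1)A(1,p^{\ell-1},p^{n+1})-A(p^{k-2},1,1)A(1,p^{\ell-1},p^n),$$ with the convention that $A(a,b,c)=0$ whenever one of $a,b,c$ is not an integer.
   Context: The coefficients satisfy the Hecke relations, in particular $A(k,1,1)A(1,\ell,d)=\sum_{c_1c_2\mid k,\ c_1\mid \ell,\ c_2\mid d}A\big(\frac{k}{c_1c_2},\frac{\ell}{c_1},\frac{dc_1}{c_2}\big)$. -}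

module Defs where

import Level
open import Level using (Level)
open import Algebra.Bundles using (CommutativeRing)
open import Data.Nat using (ℕ; zero; suc; NonZero) renaming (_*_ to _*ℕ_; _^_ to _^ℕ_)
open import Data.Nat.Divisibility using (_∣_)
open import Data.Product using (_×_; _,_; proj₁; proj₂)
open import Data.Nat.Divisibility using (_∣?_)
open import Data.Nat.DivMod using (_/_)
open import Data.Integer using (ℤ; +_; -[1+_])
open import Data.List using (List; foldr; map; upTo)
open import Relation.Nullary using (Dec; yes; no)

module GL4 {c ℓ : Level} (R : CommutativeRing c ℓ) where
  open CommutativeRing R

  ∑ : List Carrier → Carrier
  ∑ = foldr _+_ 0#

  cond? : (c₁ c₂ k l d : ℕ) → Dec ((c₁ *ℕ c₂ ∣ k) × ((c₁ ∣ l) × (c₂ ∣ d)))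
  cond? c₁ c₂ k l d with c₁ *ℕ c₂ ∣? k | c₁ ∣? l | c₂ ∣? d
  ... | yes a | yes b | yes e = yes (a , (b , e))
  ... | no ¬a | _ | _ = no (λ z → ¬a (proj₁ z))
  ... | yes _ | no ¬b | _ = no (λ z → ¬b (proj₁ (proj₂ z)))
  ... | yes _ | yes _ | no ¬e = no (λ z → ¬e (proj₂ (proj₂ z)))

  -- Right-hand side of the Hecke relation:
  --   Σ_{c₁c₂ ∣ k, c₁ ∣ ℓ, c₂ ∣ d} A(k/(c₁c₂), ℓ/c₁, d c₁ / c₂)
  -- (for k ≥ 1, c₁, c₂ range over 1..k; c₁ = suc i, c₂ = suc j).
  heckeSum : (ℕ → ℕ → ℕ → Carrier) → ℕ → ℕ → ℕ → Carrier
  heckeSum A k l d =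
    ∑ (map (λ i → ∑ (map (λ j → term i j) (upTo k))) (upTo k))
    where
    term : ℕ → ℕ → Carrier
    term i j with cond? (suc i) (suc j) k l d
    ... | yes _ = A (k / (suc i *ℕ suc j)) (l / suc i) ((d *ℕ suc i) / suc j)
    ... | no _  = 0#

  HeckeRelation : (ℕ → ℕ → ℕ → Carrier) → Set ℓ
  HeckeRelation A = (k l d : ℕ) → NonZero k → NonZero l → NonZero d →
    A k 1 1 * A 1 l d ≈ heckeSum A k l d

  -- A(p^a, p^b, p^c) for integer exponents, with the convention that it
  -- is 0 whenever some exponent is negative (entry not an integer).
  Ap : (ℕ → ℕ → ℕ → Carrier) → ℕ → ℤ → ℤ → ℤ → Carrier
  Ap A p (+ a) (+ b) (+ e) = A (p ^ℕ a) (p ^ℕ b) (p ^ℕ e)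
  Ap A p _ _ _ = 0#

-- At prime powers the divisors in the Hecke relation are c₁ = p^a and c₂ = p^b, so
--   A(p^k,1,1) A(1,p^l,p^n) = S(k,l,n) := Σ_{a+b ≤ k, a ≤ l, b ≤ n} A(p^(k-a-b), p^(l-a), p^(n+a-b)).
-- Split S(k,l,n) into the terms with b ≥ 1 and those with b = 0. Shifting b down by one identifies
-- the former with S(k-1,l,n-1). Shifting a down by one identifies the terms with b = 0, a ≥ 1 with
-- the b = 0 part of S(k-1,l-1,n+1), which by the first identification is S(k-1,l-1,n+1) - S(k-2,l-1,n).
-- What remains is the term a = b = 0, namely A(p^k,p^l,p^n); reading each S back as a product by the
-- Hecke relation gives the identity, the boundary cases being sums that are empty.
module Submission where

open import Defs
open import Algebra.Bundles using (CommutativeRing)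
open import Data.Nat using (ℕ)
open import Data.Nat.Primality using (Prime)
open import Data.Integer using (ℤ; +_) renaming (_-_ to _-ℤ_; _+_ to _+ℤ_)

open import Algebra.Bundles using (CommutativeMonoid)
open import Data.Fin.Base using (toℕ)
open import Data.Fin.Properties using (toℕ<n; toℕ-inject₁; toℕ-fromℕ)
open import Data.Integer.Properties using ([1+m]⊖[1+n]≡m⊖n)
open import Data.List.Base as List using (foldr; applyUpTo; upTo)
open import Data.List.Properties using (map-cong)
open import Data.Nat.Base
  using (zero; suc; pred; _^_; _∸_; _≤_; _<_; z≤n; s≤s; s≤s⁻¹; NonZero; >-nonZero; nonTrivial⇒n>1)
  renaming (_+_ to _+ℕ_; _*_ to _*ℕ_)
import Data.Nat.Properties as ℕ
open import Data.Nat.Properties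
  using ( _≟_; _≤?_; ≤-refl; ≤-trans; ≤-antisym; ≮⇒≥; <⇒≱; <⇒≢; 1+n≰n; m≤n+m; m≤m+n; m≤n⇒m≤1+n
        ; m<n⇒m<1+n; m≤n⇒m<n∨m≡n; m∸n+n≡m; +-suc; suc-pred; m^n≢0; ^-monoʳ-≤; ^-monoʳ-<; ^-distribˡ-+-*)
open import Data.Nat.Divisibility
  using (_∣_; _∣?_; divides; ∣-reflexive; ∣⇒≤; ∣1⇒≡1; *-cancelˡ-∣; m*n∣⇒m∣; m*n∣⇒n∣)
open import Data.Nat.DivMod using (_/_; m*n/n≡m)
open import Data.Nat.Coprimality using (Coprime; coprime-divisor)
open import Data.Nat.Primality using (prime⇒irreducible; prime⇒nonTrivial; prime⇒nonZero)
open import Data.Product.Base using (∃-syntax; _×_; _,_; proj₁; map; map₂)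
open import Data.Sum.Base using (inj₁; inj₂)
open import Function.Base using (_∘_)
open import Function.Definitions using (Injective)
open import Relation.Binary.Bundles using (Setoid)
open import Relation.Binary.PropositionalEquality using (_≡_; _≢_; refl; sym; trans; cong; cong₂; subst)
open import Relation.Nullary using (Dec; yes; no; ¬_)
open import Relation.Nullary.Decidable using (_×-dec_)
open import Relation.Nullary.Negation using (contradiction)

module _ {p : ℕ} (p-prime : Prime p) where

  ∣p^⇒≡p^ : ∀ k {d} → d ∣ p ^ k → ∃[ a ] a ≤ k × d ≡ p ^ a
  ∣p^⇒≡p^ zero d∣1 = 0 , z≤n , ∣1⇒≡1 d∣1
  ∣p^⇒≡p^ (suc k) {d} d∣p^[1+k] with p ∣? d
  ... | yes (divides q refl)
    with ∣p^⇒≡p^ k (*-cancelˡ-∣ p {{prime⇒nonZero p-prime}}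
                      (subst (_∣ p *ℕ p ^ k) (ℕ.*-comm q p) d∣p^[1+k]))
  ...   | a , a≤k , refl = suc a , s≤s a≤k , ℕ.*-comm (p ^ a) p
  ∣p^⇒≡p^ (suc k) {d} d∣p^[1+k] | no p∤d with ∣p^⇒≡p^ k (coprime-divisor d⊥p d∣p^[1+k])
    where
    d⊥p : Coprime d p
    d⊥p (i∣d , i∣p) with prime⇒irreducible p-prime i∣p
    ... | inj₁ i≡1  = i≡1
    ... | inj₂ refl = contradiction i∣d p∤d
  ... | a , a≤k , d≡p^a = a , m≤n⇒m≤1+n a≤k , d≡p^a

module _ {p : ℕ} (1<p : 1 < p) where

  private instance
    p≢0 : NonZero p
    p≢0 = >-nonZero (≤-trans (s≤s z≤n) 1<p)

  ∣p^⇒≤ : ∀ {d} a b → d ≡ p ^ a → d ∣ p ^ b → a ≤ b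
  ∣p^⇒≤ a b refl p^a∣p^b = ≮⇒≥ λ b<a → <⇒≱ (^-monoʳ-< p 1<p b<a) (∣⇒≤ {{m^n≢0 p b}} p^a∣p^b)

  p^-split : ∀ {a b} → a ≤ b → p ^ b ≡ p ^ (b ∸ a) *ℕ p ^ a
  p^-split {a} {b} a≤b = trans (cong (p ^_) (sym (m∸n+n≡m a≤b))) (^-distribˡ-+-* p (b ∸ a) a)

  ≤⇒∣p^ : ∀ {d a b} → d ≡ p ^ a → a ≤ b → d ∣ p ^ b
  ≤⇒∣p^ {a = a} {b} refl a≤b = divides (p ^ (b ∸ a)) (p^-split a≤b)

  p^-injective : Injective _≡_ _≡_ (p ^_)
  p^-injective {a} {b} p^a≡p^b =
    ≤-antisym (∣p^⇒≤ a b refl (∣-reflexive p^a≡p^b)) (∣p^⇒≤ b a refl (∣-reflexive (sym p^a≡p^b)))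

  p^/p^ : ∀ {a b d} .{{_ : NonZero d}} → d ≡ p ^ a → a ≤ b → p ^ b / d ≡ p ^ (b ∸ a)
  p^/p^ {a} {b} refl a≤b = trans (cong (_/ p ^ a) (p^-split a≤b)) (m*n/n≡m (p ^ (b ∸ a)) (p ^ a))

module NatIndexedSum {a ℓ} (M : CommutativeMonoid a ℓ) where

  open CommutativeMonoid M
    renaming ( _∙_ to _+_; ε to 0#; ∙-cong to +-cong; ∙-congˡ to +-congˡ; identityˡ to +-identityˡ
             ; comm to +-comm; refl to ≈-refl; sym to ≈-sym; trans to ≈-trans)
  open import Algebra.Properties.CommutativeMonoid.Sum M
    using (sum; sum-cong-≋; sum-cong-≗; sum-replicate-zero; ∑-distrib-+; sum-init-last)
  open import Algebra.Properties.CommutativeSemigroup commutativeSemigroup using (x∙yz≈y∙xz)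
  open import Relation.Binary.Reasoning.Setoid setoid

  sumUpTo : ℕ → (ℕ → Carrier) → Carrier
  sumUpTo n f = sum {n} (f ∘ toℕ)

  foldr-map-applyUpTo : ∀ (f : ℕ → Carrier) g n →
    foldr _+_ 0# (List.map f (applyUpTo g n)) ≡ sumUpTo n (f ∘ g)
  foldr-map-applyUpTo f g zero    = refl
  foldr-map-applyUpTo f g (suc n) = cong (_+_ (f (g 0))) (foldr-map-applyUpTo f (g ∘ suc) n)

  foldr-map-upTo : ∀ (f : ℕ → Carrier) n → foldr _+_ 0# (List.map f (upTo n)) ≡ sumUpTo n f
  foldr-map-upTo f = foldr-map-applyUpTo f (λ i → i)

  sumUpTo-cong : ∀ n {f g : ℕ → Carrier} → (∀ i → i < n → f i ≈ g i) → sumUpTo n f ≈ sumUpTo n g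
  sumUpTo-cong n f≈g = sum-cong-≋ λ i → f≈g (toℕ i) (toℕ<n i)

  sumUpTo-cong-≗ : ∀ n {f g : ℕ → Carrier} → (∀ i → f i ≡ g i) → sumUpTo n f ≡ sumUpTo n g
  sumUpTo-cong-≗ n f≗g = sum-cong-≗ {n} (f≗g ∘ toℕ)

  sumUpTo-zero : ∀ n {f : ℕ → Carrier} → (∀ i → i < n → f i ≈ 0#) → sumUpTo n f ≈ 0#
  sumUpTo-zero n f≈0 = ≈-trans (sumUpTo-cong n f≈0) (sum-replicate-zero n)

  sumUpTo-+ : ∀ n (f g : ℕ → Carrier) → sumUpTo n (λ i → f i + g i) ≈ sumUpTo n f + sumUpTo n g
  sumUpTo-+ n f g = ∑-distrib-+ {n} (f ∘ toℕ) (g ∘ toℕ)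

  sumUpTo-last : ∀ n (f : ℕ → Carrier) → sumUpTo (suc n) f ≈ sumUpTo n f + f n
  sumUpTo-last n f = ≈-trans (sum-init-last {n} (f ∘ toℕ))
    (+-cong (reflexive (sum-cong-≗ {n} (cong f ∘ toℕ-inject₁))) (reflexive (cong f (toℕ-fromℕ n))))

  erase : ℕ → (ℕ → Carrier) → ℕ → Carrier
  erase zero    h zero    = 0#
  erase zero    h (suc i) = h (suc i)
  erase (suc j) h zero    = h zero
  erase (suc j) h (suc i) = erase j (h ∘ suc) i

  erase-self : ∀ j h → erase j h j ≡ 0#
  erase-self zero    h = refl
  erase-self (suc j) h = erase-self j (h ∘ suc)

  erase-≢ : ∀ {i j} h → i ≢ j → erase j h i ≡ h i
  erase-≢ {zero}  {zero}  h i≢j = contradiction refl i≢j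
  erase-≢ {zero}  {suc j} h i≢j = refl
  erase-≢ {suc i} {zero}  h i≢j = refl
  erase-≢ {suc i} {suc j} h i≢j = erase-≢ (h ∘ suc) (i≢j ∘ cong suc)

  sumUpTo-erase : ∀ {N j} h → j < N → sumUpTo N h ≈ h j + sumUpTo N (erase j h)
  sumUpTo-erase {suc N} {zero}  h _         = +-congˡ (≈-sym (+-identityˡ _))
  sumUpTo-erase {suc N} {suc j} h (s≤s j<N) = begin
    h 0 + sumUpTo N (h ∘ suc)                          ≈⟨ +-congˡ (sumUpTo-erase (h ∘ suc) j<N) ⟩
    h 0 + (h (suc j) + sumUpTo N (erase j (h ∘ suc)))  ≈⟨ x∙yz≈y∙xz _ _ _ ⟩
    h (suc j) + (h 0 + sumUpTo N (erase j (h ∘ suc)))  ∎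

  sumUpTo-reindex : ∀ m {N} (e : ℕ → ℕ) (h : ℕ → Carrier) → Injective _≡_ _≡_ e →
    (∀ a → a < m → e a < N) → (∀ i → (∀ a → a < m → i ≢ e a) → h i ≈ 0#) →
    sumUpTo N h ≈ sumUpTo m (h ∘ e)
  sumUpTo-reindex zero    {N} e h e-inj e<N h≈0 = sumUpTo-zero N λ i _ → h≈0 i λ _ ()
  sumUpTo-reindex (suc m) {N} e h e-inj e<N h≈0 = begin
    sumUpTo N h
      ≈⟨ sumUpTo-erase h (e<N m ≤-refl) ⟩
    h (e m) + sumUpTo N (erase (e m) h)
      ≈⟨ +-congˡ (sumUpTo-reindex m e (erase (e m) h) e-inj (λ a a<m → e<N a (m<n⇒m<1+n a<m)) erased≈0) ⟩
    h (e m) + sumUpTo m (erase (e m) h ∘ e)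
      ≈⟨ +-congˡ (sumUpTo-cong m λ a a<m → reflexive (erase-≢ h (<⇒≢ a<m ∘ e-inj))) ⟩
    h (e m) + sumUpTo m (h ∘ e)
      ≈⟨ +-comm _ _ ⟩
    sumUpTo m (h ∘ e) + h (e m)
      ≈⟨ sumUpTo-last m (h ∘ e) ⟨
    sumUpTo (suc m) (h ∘ e) ∎
    where
    erased≈0 : ∀ i → (∀ a → a < m → i ≢ e a) → erase (e m) h i ≈ 0#
    erased≈0 i i∉e[m] with i ≟ e m
    ... | yes refl = reflexive (erase-self (e m) h)
    ... | no i≢em  = ≈-trans (reflexive (erase-≢ h i≢em)) (h≈0 i i∉e[1+m])
      where
      i∉e[1+m] : ∀ a → a < suc m → i ≢ e a
      i∉e[1+m] a a<1+m with m≤n⇒m<n∨m≡n (s≤s⁻¹ a<1+m)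
      ... | inj₁ a<m  = i∉e[m] a a<m
      ... | inj₂ refl = i≢em

module Guard {a ℓ} (S : Setoid a ℓ) (0# : Setoid.Carrier S) where

  open Setoid S using (Carrier; _≈_) renaming (refl to ≈-refl)

  guard : {P : Set} → Dec P → Carrier → Carrier
  guard (yes _) x = x
  guard (no _)  x = 0#

  guard-yes : ∀ {P : Set} (P? : Dec P) {x : Carrier} → P → guard P? x ≈ x
  guard-yes (yes _) _  = ≈-refl
  guard-yes (no ¬P) pf = contradiction pf ¬P

  guard-no : ∀ {P : Set} (P? : Dec P) {x : Carrier} → ¬ P → guard P? x ≈ 0#
  guard-no (yes pf) ¬P = contradiction pf ¬P
  guard-no (no _)   _  = ≈-refl

  guard-cong : ∀ {P Q : Set} (P? : Dec P) (Q? : Dec Q) {x y : Carrier} →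
    (P → Q) → (Q → P) → (Q → x ≈ y) → guard P? x ≈ guard Q? y
  guard-cong (yes _)  (yes qf) _   _   x≈y = x≈y qf
  guard-cong (yes pf) (no ¬Q)  P→Q _   _   = contradiction (P→Q pf) ¬Q
  guard-cong (no ¬P)  (yes qf) _   Q→P _   = contradiction (Q→P qf) ¬P
  guard-cong (no _)   (no _)   _   _   _   = ≈-refl

module HeckeAtPrimePowers {c ℓ} (R : CommutativeRing c ℓ)
  (A : ℕ → ℕ → ℕ → CommutativeRing.Carrier R) {p : ℕ} (p-prime : Prime p) where

  open CommutativeRing R renaming (refl to ≈-refl; sym to ≈-sym; trans to ≈-trans)
  open GL4 R
  open NatIndexedSum +-commutativeMonoid
  open Guard setoid 0#
  open import Algebra.Properties.Group +-group using (//-rightDividesʳ)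
  open import Relation.Binary.Reasoning.Setoid setoid

  G : ℕ → ℕ → ℕ → Carrier
  G a b e = A (p ^ a) (p ^ b) (p ^ e)

  summand-cond? : ∀ k l n a b → Dec ((b +ℕ a ≤ k) × (a ≤ l) × (b ≤ n))
  summand-cond? k l n a b = (b +ℕ a ≤? k) ×-dec ((a ≤? l) ×-dec (b ≤? n))

  summand : ℕ → ℕ → ℕ → ℕ → ℕ → Carrier
  summand k l n a b = guard (summand-cond? k l n a b) (G (k ∸ (b +ℕ a)) (l ∸ a) (n +ℕ a ∸ b))

  S S₀ S₊ : ℕ → ℕ → ℕ → Carrier
  S  k l n = sumUpTo (suc k) λ a → sumUpTo (suc k) λ b → summand k l n a b
  S₀ k l n = sumUpTo (suc k) λ a → summand k l n a 0
  S₊ k l n = sumUpTo (suc k) λ a → sumUpTo k λ b → summand k l n a (suc b)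

  heckeTerm : ℕ → ℕ → ℕ → ℕ → ℕ → Carrier
  heckeTerm k l d i j = guard (cond? (suc i) (suc j) k l d)
    (A (k / (suc i *ℕ suc j)) (l / suc i) ((d *ℕ suc i) / suc j))

  mutual
    heckeSum≡sumUpTo : ∀ k l d → heckeSum A k l d ≡ sumUpTo k (λ i → sumUpTo k (heckeTerm k l d i))
    heckeSum≡sumUpTo k l d = trans
      (cong ∑ (map-cong (λ i → cong ∑ (map-cong (term≡heckeTerm k l d i) (upTo k))) (upTo k)))
      (trans (foldr-map-upTo _ k) (sumUpTo-cong-≗ k λ i → foldr-map-upTo (heckeTerm k l d i) k))

    -- The left-hand side is the local summand of heckeSum, which cannot be named; the use above fixes it.
    term≡heckeTerm : ∀ k l d i j → _ ≡ heckeTerm k l d i j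
    term≡heckeTerm k l d i j with cond? (suc i) (suc j) k l d
    ... | yes _ = refl
    ... | no _  = refl

  1<p : 1 < p
  1<p = nonTrivial⇒n>1 p {{prime⇒nonTrivial p-prime}}

  private instance
    p≢0 : NonZero p
    p≢0 = prime⇒nonZero p-prime

  A-cong : ∀ {a a′ b b′ e e′} → a ≡ a′ → b ≡ b′ → e ≡ e′ → A a b e ≈ A a′ b′ e′
  A-cong refl refl refl = ≈-refl

  -- heckeSum puts the divisor c at position c - 1, so p^a sits at position index a.
  index : ℕ → ℕ
  index a = pred (p ^ a)

  suc-index : ∀ a → suc (index a) ≡ p ^ a
  suc-index a = suc-pred (p ^ a) {{m^n≢0 p a}}

  index-injective : Injective _≡_ _≡_ index
  index-injective {a} {b} eq =
    p^-injective 1<p (trans (sym (suc-index a)) (trans (cong suc eq) (suc-index b)))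

  index<p^ : ∀ {k} a → a < suc k → index a < p ^ k
  index<p^ {k} a a<1+k = subst (_≤ p ^ k) (sym (suc-index a)) (^-monoʳ-≤ p (s≤s⁻¹ a<1+k))

  ∉index⇒∤p^ : ∀ {k i} → (∀ a → a < suc k → i ≢ index a) → ¬ (suc i ∣ p ^ k)
  ∉index⇒∤p^ {k} i∉index 1+i∣p^k with ∣p^⇒≡p^ p-prime k 1+i∣p^k
  ... | a , a≤k , 1+i≡p^a = i∉index a (s≤s a≤k) (cong pred (trans 1+i≡p^a (sym (suc-index a))))

  heckeTerm-p^ : ∀ k l n a b → heckeTerm (p ^ k) (p ^ l) (p ^ n) (index a) (index b) ≈ summand k l n a b
  heckeTerm-p^ k l n a b =
    guard-cong (cond? (suc (index a)) (suc (index b)) (p ^ k) (p ^ l) (p ^ n)) (summand-cond? k l n a b)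
      (map (∣p^⇒≤ 1<p (b +ℕ a) k c₁c₂≡p^[b+a])
           (map (∣p^⇒≤ 1<p a l (suc-index a)) (∣p^⇒≤ 1<p b n (suc-index b))))
      (map (≤⇒∣p^ 1<p c₁c₂≡p^[b+a]) (map (≤⇒∣p^ 1<p (suc-index a)) (≤⇒∣p^ 1<p (suc-index b))))
      λ (b+a≤k , a≤l , b≤n) → A-cong
        (p^/p^ 1<p c₁c₂≡p^[b+a] b+a≤k)
        (p^/p^ 1<p (suc-index a) a≤l)
        (trans (cong (_/ suc (index b)) p^n*c₁≡p^[n+a])
               (p^/p^ 1<p (suc-index b) (≤-trans b≤n (m≤m+n n a))))
    where
    c₁c₂≡p^[b+a] : suc (index a) *ℕ suc (index b) ≡ p ^ (b +ℕ a)
    c₁c₂≡p^[b+a] = trans (cong₂ _*ℕ_ (suc-index a) (suc-index b))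
      (trans (ℕ.*-comm (p ^ a) (p ^ b)) (sym (^-distribˡ-+-* p b a)))

    p^n*c₁≡p^[n+a] : p ^ n *ℕ suc (index a) ≡ p ^ (n +ℕ a)
    p^n*c₁≡p^[n+a] = trans (cong (p ^ n *ℕ_) (suc-index a)) (sym (^-distribˡ-+-* p n a))

  heckeSum-p^ : ∀ k l n → heckeSum A (p ^ k) (p ^ l) (p ^ n) ≈ S k l n
  heckeSum-p^ k l n = begin
    heckeSum A (p ^ k) (p ^ l) (p ^ n)
      ≡⟨ heckeSum≡sumUpTo (p ^ k) (p ^ l) (p ^ n) ⟩
    sumUpTo (p ^ k) (λ i → sumUpTo (p ^ k) (h i))
      ≈⟨ sumUpTo-reindex (suc k) index _ index-injective index<p^ rows-off-index-vanish ⟩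
    sumUpTo (suc k) (λ a → sumUpTo (p ^ k) (h (index a)))
      ≈⟨ sumUpTo-cong (suc k) (λ a _ →
           sumUpTo-reindex (suc k) index _ index-injective index<p^ (entries-off-index-vanish a)) ⟩
    sumUpTo (suc k) (λ a → sumUpTo (suc k) (λ b → h (index a) (index b)))
      ≈⟨ sumUpTo-cong (suc k) (λ a _ → sumUpTo-cong (suc k) λ b _ → heckeTerm-p^ k l n a b) ⟩
    S k l n ∎
    where
    h : ℕ → ℕ → Carrier
    h = heckeTerm (p ^ k) (p ^ l) (p ^ n)

    rows-off-index-vanish : ∀ i → (∀ a → a < suc k → i ≢ index a) → sumUpTo (p ^ k) (h i) ≈ 0#
    rows-off-index-vanish i i∉index = sumUpTo-zero (p ^ k) {h i} λ j _ →
      guard-no (cond? (suc i) (suc j) (p ^ k) (p ^ l) (p ^ n))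
        (∉index⇒∤p^ i∉index ∘ m*n∣⇒m∣ (suc i) (suc j) ∘ proj₁)

    entries-off-index-vanish : ∀ a j → (∀ b → b < suc k → j ≢ index b) → h (index a) j ≈ 0#
    entries-off-index-vanish a j j∉index =
      guard-no (cond? (suc (index a)) (suc j) (p ^ k) (p ^ l) (p ^ n))
        (∉index⇒∤p^ j∉index ∘ m*n∣⇒n∣ (suc (index a)) (suc j) ∘ proj₁)

  summand-00 : ∀ k l n → summand k l n 0 0 ≈ G k l n
  summand-00 k l n = ≈-trans (guard-yes (summand-cond? k l n 0 0) (z≤n , z≤n , z≤n))
    (A-cong refl refl (cong (p ^_) (ℕ.+-identityʳ n)))

  summand-shift-b : ∀ k l n a b → summand (suc k) l (suc n) a (suc b) ≈ summand k l n a b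
  summand-shift-b k l n a b =
    guard-cong (summand-cond? (suc k) l (suc n) a (suc b)) (summand-cond? k l n a b)
      (map s≤s⁻¹ (map₂ s≤s⁻¹)) (map s≤s (map₂ s≤s)) λ _ → ≈-refl

  summand-shift-a : ∀ k l n a → summand (suc k) (suc l) n (suc a) 0 ≈ summand k l (suc n) a 0
  summand-shift-a k l n a =
    guard-cong (summand-cond? (suc k) (suc l) n (suc a) 0) (summand-cond? k l (suc n) a 0)
      (map s≤s⁻¹ (map s≤s⁻¹ λ _ → z≤n)) (map s≤s (map s≤s λ _ → z≤n))
      λ _ → A-cong refl refl (cong (p ^_) (+-suc n a))

  summand-n0 : ∀ k l a b → summand k l 0 a (suc b) ≈ 0#
  summand-n0 k l a b = guard-no (summand-cond? k l 0 a (suc b)) λ ()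

  summand-l0 : ∀ k n a b → summand k 0 n (suc a) b ≈ 0#
  summand-l0 k n a b = guard-no (summand-cond? k 0 n (suc a) b) λ ()

  summand-a>k : ∀ k l n b → summand k l n (suc k) b ≈ 0#
  summand-a>k k l n b = guard-no (summand-cond? k l n (suc k) b)
    λ (b+1+k≤k , _) → 1+n≰n (≤-trans (m≤n+m (suc k) b) b+1+k≤k)

  S≈S₀+S₊ : ∀ k l n → S k l n ≈ S₀ k l n + S₊ k l n
  S≈S₀+S₊ k l n =
    sumUpTo-+ (suc k) (λ a → summand k l n a 0) (λ a → sumUpTo k λ b → summand k l n a (suc b))

  S₀≈S-S₊ : ∀ k l n → S₀ k l n ≈ S k l n - S₊ k l n
  S₀≈S-S₊ k l n =
    ≈-trans (≈-sym (//-rightDividesʳ (S₊ k l n) (S₀ k l n))) (+-congʳ (≈-sym (S≈S₀+S₊ k l n)))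

  S₊-shift : ∀ k l n → S₊ (suc k) l (suc n) ≈ S k l n
  S₊-shift k l n = begin
    S₊ (suc k) l (suc n)
      ≈⟨ sumUpTo-cong (suc (suc k)) (λ a _ → sumUpTo-cong (suc k) λ b _ → summand-shift-b k l n a b) ⟩
    sumUpTo (suc (suc k)) (λ a → sumUpTo (suc k) (summand k l n a))
      ≈⟨ sumUpTo-last (suc k) (λ a → sumUpTo (suc k) (summand k l n a)) ⟩
    S k l n + sumUpTo (suc k) (summand k l n (suc k))
      ≈⟨ +-congˡ (sumUpTo-zero (suc k) λ b _ → summand-a>k k l n b) ⟩
    S k l n + 0#
      ≈⟨ +-identityʳ _ ⟩
    S k l n ∎

  S₊-n0 : ∀ k l → S₊ k l 0 ≈ 0#
  S₊-n0 k l = sumUpTo-zero (suc k) λ a _ → sumUpTo-zero k λ b _ → summand-n0 k l a b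

  S₊-k0 : ∀ l n → S₊ 0 l n ≈ 0#
  S₊-k0 l n = sumUpTo-zero 1 λ _ _ → ≈-refl

  S₀-shift : ∀ k l n → S₀ (suc k) (suc l) n ≈ G (suc k) (suc l) n + S₀ k l (suc n)
  S₀-shift k l n = +-cong (summand-00 (suc k) (suc l) n) (sumUpTo-cong (suc k) λ a _ → summand-shift-a k l n a)

  S₀-l0 : ∀ k n → S₀ k 0 n ≈ G k 0 n
  S₀-l0 k n = ≈-trans (+-cong (summand-00 k 0 n) (sumUpTo-zero k λ a _ → summand-l0 k n a 0)) (+-identityʳ _)

  S₀-k0 : ∀ l n → S₀ 0 l n ≈ G 0 l n
  S₀-k0 l n = ≈-trans (+-congʳ (summand-00 0 l n)) (+-identityʳ _)

  x+[y-z]≈x : ∀ {x y z} → y ≈ 0# → z ≈ 0# → x + (y - z) ≈ x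
  x+[y-z]≈x {x} {y} {z} y≈0 z≈0 = begin
    x + (y - z)    ≈⟨ +-congˡ (+-cong y≈0 (-‿cong z≈0)) ⟩
    x + (0# - 0#)  ≈⟨ +-congˡ (-‿inverseʳ 0#) ⟩
    x + 0#         ≈⟨ +-identityʳ x ⟩
    x              ∎

  P : ℤ → ℤ → ℤ → Carrier
  P a b e = Ap A p a (+ 0) (+ 0) * Ap A p (+ 0) b e

  module _ (hecke : HeckeRelation A) where

    hecke-p^ : ∀ k l n → G k 0 0 * G 0 l n ≈ S k l n
    hecke-p^ k l n =
      ≈-trans (hecke (p ^ k) (p ^ l) (p ^ n) (m^n≢0 p k) (m^n≢0 p l) (m^n≢0 p n)) (heckeSum-p^ k l n)

    S₊≈P : ∀ k l n → S₊ k l n ≈ P (+ k -ℤ + 1) (+ l) (+ n -ℤ + 1)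
    S₊≈P zero    l n       = ≈-trans (S₊-k0 l n) (≈-sym (zeroˡ _))
    S₊≈P (suc k) l zero    = ≈-trans (S₊-n0 (suc k) l) (≈-sym (zeroʳ _))
    S₊≈P (suc k) l (suc n) = ≈-trans (S₊-shift k l n) (≈-sym (hecke-p^ k l n))

    S₀≈G+P-P : ∀ k l n → S₀ k l n ≈
      G k l n + (P (+ k -ℤ + 1) (+ l -ℤ + 1) (+ n +ℤ + 1) - P (+ k -ℤ + 2) (+ l -ℤ + 1) (+ n))
    S₀≈G+P-P k       zero    n = ≈-trans (S₀-l0 k n) (≈-sym (x+[y-z]≈x (zeroʳ _) (zeroʳ _)))
    S₀≈G+P-P zero    (suc l) n = ≈-trans (S₀-k0 (suc l) n) (≈-sym (x+[y-z]≈x (zeroˡ _) (zeroˡ _)))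
    S₀≈G+P-P (suc k) (suc l) n = begin
      S₀ (suc k) (suc l) n
        ≈⟨ S₀-shift k l n ⟩
      G (suc k) (suc l) n + S₀ k l (suc n)
        ≈⟨ +-congˡ (S₀≈S-S₊ k l (suc n)) ⟩
      G (suc k) (suc l) n + (S k l (suc n) - S₊ k l (suc n))
        ≈⟨ +-congˡ (+-cong (≈-sym (hecke-p^ k l (suc n))) (-‿cong (S₊≈P k l (suc n)))) ⟩
      G (suc k) (suc l) n + (G k 0 0 * G 0 l (suc n) - P (+ k -ℤ + 1) (+ l) (+ n))
        -- + n +ℤ + 1 is + (n +ℕ 1), and + suc k -ℤ + 2 is stuck on k.
        ≡⟨ cong₂ (λ e i → G (suc k) (suc l) n + (G k 0 0 * G 0 l e - P i (+ l) (+ n)))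
                 (ℕ.+-comm 1 n) (sym ([1+m]⊖[1+n]≡m⊖n k 1)) ⟩
      G (suc k) (suc l) n + (P (+ k) (+ l) (+ n +ℤ + 1) - P (+ suc k -ℤ + 2) (+ l) (+ n)) ∎

lemma3p3 : ∀ {c ℓ} (R : CommutativeRing c ℓ) → let open CommutativeRing R in let open GL4 R in
    (A : ℕ → ℕ → ℕ → Carrier) → A 1 1 1 ≈ 1# → HeckeRelation A →
    (p : ℕ) → Prime p → (k l n : ℕ) →
    Ap A p (+ k) (+ 0) (+ 0) * Ap A p (+ 0) (+ l) (+ n)
      ≈ Ap A p (+ k) (+ l) (+ n)
        + Ap A p (+ k -ℤ + 1) (+ 0) (+ 0) * Ap A p (+ 0) (+ l) (+ n -ℤ + 1)
        + Ap A p (+ k -ℤ + 1) (+ 0) (+ 0) * Ap A p (+ 0) (+ l -ℤ + 1) (+ n +ℤ + 1)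
        - Ap A p (+ k -ℤ + 2) (+ 0) (+ 0) * Ap A p (+ 0) (+ l -ℤ + 1) (+ n)
lemma3p3 R A _ hecke p p-prime k l n = begin
  G k 0 0 * G 0 l n      ≈⟨ hecke-p^ hecke k l n ⟩
  S k l n                ≈⟨ S≈S₀+S₊ k l n ⟩
  S₀ k l n + S₊ k l n    ≈⟨ +-cong (S₀≈G+P-P hecke k l n) (S₊≈P hecke k l n) ⟩
  G k l n + (Y - W) + X  ≈⟨ solve 4 (λ g y w x → (g ⊕ (y ⊕ w)) ⊕ x ⊜ ((g ⊕ x) ⊕ y) ⊕ w)
                                     ≈-refl (G k l n) Y (- W) X ⟩
  G k l n + X + Y - W    ∎
  where
  open CommutativeRing R renaming (refl to ≈-refl)
  open HeckeAtPrimePowers R A p-prime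
  open import Algebra.Solver.CommutativeMonoid +-commutativeMonoid using (solve; _⊕_; _⊜_)
  open import Relation.Binary.Reasoning.Setoid setoid

  X Y W : Carrier
  X = P (+ k -ℤ + 1) (+ l) (+ n -ℤ + 1)
  Y = P (+ k -ℤ + 1) (+ l -ℤ + 1) (+ n +ℤ + 1)
  W = P (+ k -ℤ + 2) (+ l -ℤ + 1) (+ n)
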